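{- Let $d\geq2$ and let $A_d\subset\mathbb{Z}^d$ consist of the $d$ vectors $(1,1,1,\ldots,1)$ and, for each $j=2,\ldots,d$, the vector with $2$ in coordinate $j$ and $1$ in every other coordinate. Then for every integer $t\geq1$ the Cayley digraph $G_{d,t}=\mathrm{Cay}\big(\mathbb{Z}_t\oplus\mathbb{Z}_{t(d+1)}^{(d-1)},A_d\big)$ has diameter $k_{d,t}=t\binom{d+1}{2}-d$.
   Context: $\mathbb{Z}_m$ denotes the cyclic group of integers modulo $m$, and $\mathbb{Z}_m^{(d-1)}=\mathbb{Z}_m\oplus\cdots\oplus\mathbb{Z}_m$ ($d-1$ summands). The vectors of $A_d$ are interpreted in $\mathbb{Z}_t\oplus\mathbb{Z}_{t(d+1)}^{(d-1)}$ by reducing the first coordinate modulo $t$ and the others modulo $t(d+1)$. The diameter of a Cayley digraph is the maximum over vertices $v$ of the length of a shortest directed path from $0$ to $v$ using the generators as arcs. -}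

module Defs where

open import Data.Nat using (ℕ; zero; suc; _*_; _≤_; ∣_-_∣)
open import Data.Nat.Divisibility using (_∣_)
open import Data.Fin using (Fin; zero; suc; toℕ; _≟_)
open import Data.List using (List; map; length)
open import Data.Nat.ListAction using (sum)
open import Data.Product using (Σ; _×_; ∃)
open import Relation.Nullary using (does)
open import Data.Bool using (if_then_else_)

modulus : (d t : ℕ) → Fin d → ℕ
modulus d t zero    = t
modulus d t (suc _) = t * suc d

Vertex : (d t : ℕ) → Set
Vertex d t = (i : Fin d) → Fin (modulus d t i)

-- Generators A_d (0-indexed): generator 0 is (1,…,1); generator j ≠ 0
-- has 2 in coordinate j and 1 elsewhere.  gen j i = i-th coordinate.
gen : {d : ℕ} → Fin d → Fin d → ℕ
gen zero    i = 1
gen (suc j) i = if does (i ≟ suc j) then 2 else 1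

-- A directed walk from 0 is a list of generators (arcs x → x + a);
-- its endpoint (as an integer vector, before reduction) is the sum.
endpoint : {d : ℕ} → List (Fin d) → Fin d → ℕ
endpoint w i = sum (map (λ g → gen g i) w)

Reaches : (d t : ℕ) → List (Fin d) → Vertex d t → Set
Reaches d t w v = ∀ i → modulus d t i ∣ ∣ endpoint w i - toℕ (v i) ∣

HasDiameter : (d t k : ℕ) → Set
HasDiameter d t k =
  ((v : Vertex d t) → ∃ λ w → length w ≤ k × Reaches d t w v)
  × (∃ λ (v : Vertex d t) → ∀ w → Reaches d t w v → k ≤ length w)

-- A walk from 0 ends at a vertex determined by how often it uses each generator: with
-- multiplicities a, the endpoint has coordinate Σa modulo t and Σa + a_j modulo t(d+1)
-- for j ≠ 0.  Two multiplicity vectors give the same vertex if they agree componentwise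
-- modulo t(d+1), or if one is the other plus a common multiple of t.
--
-- Upper bound: write a_i = t y_i + z_i with z_i < t.  Shifting every y_i by the same l and
-- reducing modulo d+1 leaves the vertex unchanged; for the l minimising the residue sum
-- Σ (y_i + l) mod (d+1), at most j of the residues wrap around under a further shift by
-- j + 1, which forces that sum to be at most C(d,2).  The walk then has length at most
-- t C(d,2) + d(t-1) = k.
--
-- Lower bound: every walk to the vertex of the multiplicities t i + t - 1 has
-- multiplicities t - 1 + t q_i with q_i ≡ i + c modulo d+1 for a constant c, and the
-- residues of 0 + c, …, (d-1) + c modulo d+1 already sum to at least C(d,2).

module Submission where

open import Data.Nat hiding (_≟_)
open import Data.Nat.Properties hiding (_≟_)
open import Data.Nat.Combinatorics using (_C_; nC1≡n; nCk+nC[k+1]≡[n+1]C[k+1])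
open import Data.Nat.Divisibility using (_∣_; divides)
open import Data.Nat.DivMod
open import Data.Nat.Tactic.RingSolver using (solve; solve-∀)
open import Algebra.Properties.CommutativeSemigroup +-commutativeSemigroup using (x∙yz≈y∙xz)
open import Algebra.Properties.Semiring.Sum +-*-semiring
  using (sum; sum-syntax; sum-cong-≗; ∑-distrib-+; ∑-comm; *-distribˡ-sum; *-distribʳ-sum)
open import Data.Bool using (true; false; if_then_else_)
open import Data.Fin using (Fin; zero; suc; toℕ; fromℕ<; _≟_)
open import Data.Fin.Properties using (toℕ<n; toℕ-fromℕ<)
open import Data.List using (List; []; _∷_; _++_; map; length; replicate)
open import Data.Product using (∃; _×_; _,_; proj₁; proj₂)
open import Data.Sum using (inj₁; inj₂; [_,_]′)
open import Function using (_∘_)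
open import Level using (0ℓ)
open import Relation.Binary.Bundles using (Setoid)
open import Relation.Binary.PropositionalEquality
import Relation.Binary.Reasoning.Setoid
open import Relation.Nullary using (does; yes; no)

open import Defs

infix 4 _≡_[mod_]

record _≡_[mod_] (x y m : ℕ) : Set where
  constructor by-multiples
  field
    k₁ k₂    : ℕ
    balanced : x + k₁ * m ≡ y + k₂ * m

module _ {m : ℕ} where

  open ≡-Reasoning

  mod-refl : ∀ {x} → x ≡ x [mod m ]
  mod-refl = by-multiples 0 0 refl

  mod-reflexive : ∀ {x y} → x ≡ y → x ≡ y [mod m ]
  mod-reflexive refl = mod-refl

  mod-sym : ∀ {x y} → x ≡ y [mod m ] → y ≡ x [mod m ]
  mod-sym (by-multiples a b e) = by-multiples b a (sym e)

  mod-trans : ∀ {x y z} → x ≡ y [mod m ] → y ≡ z [mod m ] → x ≡ z [mod m ]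
  mod-trans {x} {y} {z} (by-multiples a b e) (by-multiples c d f) = by-multiples (a + c) (b + d) (begin
    x + (a + c) * m     ≡⟨ solve (x ∷ a ∷ c ∷ m ∷ []) ⟩
    (x + a * m) + c * m ≡⟨ cong (_+ c * m) e ⟩
    (y + b * m) + c * m ≡⟨ solve (y ∷ b ∷ c ∷ m ∷ []) ⟩
    (y + c * m) + b * m ≡⟨ cong (_+ b * m) f ⟩
    (z + d * m) + b * m ≡⟨ solve (z ∷ b ∷ d ∷ m ∷ []) ⟩
    z + (b + d) * m     ∎)

  mod-+ : ∀ {x y u v} → x ≡ y [mod m ] → u ≡ v [mod m ] → x + u ≡ y + v [mod m ]
  mod-+ {x} {y} {u} {v} (by-multiples a b e) (by-multiples c d f) = by-multiples (a + c) (b + d) (begin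
    x + u + (a + c) * m       ≡⟨ solve (x ∷ u ∷ a ∷ c ∷ m ∷ []) ⟩
    (x + a * m) + (u + c * m) ≡⟨ cong₂ _+_ e f ⟩
    (y + b * m) + (v + d * m) ≡⟨ solve (y ∷ v ∷ b ∷ d ∷ m ∷ []) ⟩
    y + v + (b + d) * m       ∎)

  mod-+ˡ : ∀ z {x y} → x ≡ y [mod m ] → z + x ≡ z + y [mod m ]
  mod-+ˡ z = mod-+ (mod-refl {z})

  mod-+ʳ : ∀ z {x y} → x ≡ y [mod m ] → x + z ≡ y + z [mod m ]
  mod-+ʳ z x≡y = mod-+ x≡y (mod-refl {z})

  mod-+-cancelˡ : ∀ {x y u v} → x ≡ y [mod m ] → x + u ≡ y + v [mod m ] → u ≡ v [mod m ]
  mod-+-cancelˡ {x} {y} {u} {v} (by-multiples a b e) (by-multiples c d f) = by-multiples (c + b) (d + a)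
    (+-cancelˡ-≡ (x + y) _ _ (begin
      x + y + (u + (c + b) * m)     ≡⟨ solve (x ∷ y ∷ u ∷ c ∷ b ∷ m ∷ []) ⟩
      (x + u + c * m) + (y + b * m) ≡⟨ cong₂ _+_ f (sym e) ⟩
      (y + v + d * m) + (x + a * m) ≡⟨ solve (x ∷ y ∷ v ∷ a ∷ d ∷ m ∷ []) ⟩
      x + y + (v + (d + a) * m)     ∎))

  +-multiple≡[mod] : ∀ x k → x + k * m ≡ x [mod m ]
  +-multiple≡[mod] x k = by-multiples 0 k (+-identityʳ _)

  mod⇒%≡% : ∀ {x y} .{{_ : NonZero m}} → x ≡ y [mod m ] → x % m ≡ y % m
  mod⇒%≡% {x} {y} (by-multiples a b e) = begin
    x % m           ≡⟨ [m+kn]%n≡m%n x a m ⟨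
    (x + a * m) % m ≡⟨ cong (_% m) e ⟩
    (y + b * m) % m ≡⟨ [m+kn]%n≡m%n y b m ⟩
    y % m           ∎

  %≡[mod] : ∀ x .{{_ : NonZero m}} → x % m ≡ x [mod m ]
  %≡[mod] x = by-multiples (x / m) 0 (trans (sym (m≡m%n+[m/n]*n x m)) (sym (+-identityʳ x)))

  mod⇒∣∣-∣ : ∀ {x y} → x ≡ y [mod m ] → m ∣ ∣ x - y ∣
  mod⇒∣∣-∣ {x} {y} (by-multiples a b e) = divides ∣ b - a ∣ (begin
    ∣ x - y ∣                 ≡⟨ ∣m+n-m+o∣≡∣n-o∣ (a * m) x y ⟨
    ∣ a * m + x - a * m + y ∣ ≡⟨ cong₂ ∣_-_∣ (trans (+-comm (a * m) x) e) (+-comm (a * m) y) ⟩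
    ∣ y + b * m - y + a * m ∣ ≡⟨ ∣m+n-m+o∣≡∣n-o∣ y (b * m) (a * m) ⟩
    ∣ b * m - a * m ∣         ≡⟨ *-distribʳ-∣-∣ m b a ⟨
    ∣ b - a ∣ * m             ∎)

  ∣∣-∣⇒mod : ∀ {x y} → m ∣ ∣ x - y ∣ → x ≡ y [mod m ]
  ∣∣-∣⇒mod {x} {y} (divides q e) with ≤-total x y
  ... | inj₁ x≤y = by-multiples q 0 (begin
    x + q * m     ≡⟨ cong (x +_) e ⟨
    x + ∣ x - y ∣ ≡⟨ cong (x +_) (m≤n⇒∣m-n∣≡n∸m x≤y) ⟩
    x + (y ∸ x)   ≡⟨ m+[n∸m]≡n x≤y ⟩
    y             ≡⟨ +-identityʳ y ⟨
    y + 0 * m     ∎)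
  ... | inj₂ y≤x = by-multiples 0 q (begin
    x + 0 * m     ≡⟨ +-identityʳ x ⟩
    x             ≡⟨ m+[n∸m]≡n y≤x ⟨
    y + (x ∸ y)   ≡⟨ cong (y +_) (m≤n⇒∣n-m∣≡n∸m y≤x) ⟨
    y + ∣ x - y ∣ ≡⟨ cong (y +_) e ⟩
    y + q * m     ∎)

mod-*ʳ-weaken : ∀ {m} c {x y} → x ≡ y [mod m * c ] → x ≡ y [mod m ]
mod-*ʳ-weaken {m} c {x} {y} (by-multiples a b e) = by-multiples (a * c) (b * c) (begin
  x + a * c * m   ≡⟨ cong (x +_) (regroup a) ⟩
  x + a * (m * c) ≡⟨ e ⟩
  y + b * (m * c) ≡⟨ cong (y +_) (regroup b) ⟨
  y + b * c * m   ∎)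
  where
  open ≡-Reasoning
  regroup : ∀ k → k * c * m ≡ k * (m * c)
  regroup k = trans (*-assoc k c m) (cong (k *_) (*-comm c m))

mod-*-cancelˡ : ∀ t {m x y} .{{_ : NonZero t}} → t * x ≡ t * y [mod t * m ] → x ≡ y [mod m ]
mod-*-cancelˡ t {m} {x} {y} (by-multiples a b e) = by-multiples a b (*-cancelˡ-≡ (x + a * m) (y + b * m) t (begin
  t * (x + a * m)     ≡⟨ solve (t ∷ x ∷ a ∷ m ∷ []) ⟩
  t * x + a * (t * m) ≡⟨ e ⟩
  t * y + b * (t * m) ≡⟨ solve (t ∷ y ∷ b ∷ m ∷ []) ⟩
  t * (y + b * m)     ∎))
  where open ≡-Reasoning

≡[mod]-setoid : ℕ → Setoid 0ℓ 0ℓ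
≡[mod]-setoid m = record
  { Carrier       = ℕ
  ; _≈_           = _≡_[mod m ]
  ; isEquivalence = record { refl = mod-refl ; sym = mod-sym ; trans = mod-trans }
  }

module ≡[mod]-Reasoning (m : ℕ) = Relation.Binary.Reasoning.Setoid (≡[mod]-setoid m)

∑-const : ∀ n c → ∑[ i < n ] c ≡ n * c
∑-const zero    c = refl
∑-const (suc n) c = cong (c +_) (∑-const n c)

∑-const+ : ∀ {n} c (a : Fin n → ℕ) → ∑[ i < n ] (c + a i) ≡ n * c + sum a
∑-const+ {n} c a = trans (∑-distrib-+ (λ _ → c) a) (cong (_+ sum a) (∑-const n c))

∑-affine : ∀ {n} r t (q : Fin n → ℕ) → ∑[ i < n ] (r + t * q i) ≡ n * r + t * sum q
∑-affine {n} r t q = trans (∑-const+ r (λ i → t * q i)) (cong (n * r +_) (sym (*-distribˡ-sum t q)))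

∑-mono-≤ : ∀ {n} {f g : Fin n → ℕ} → (∀ i → f i ≤ g i) → sum f ≤ sum g
∑-mono-≤ {zero}  f≤g = z≤n
∑-mono-≤ {suc n} f≤g = +-mono-≤ (f≤g zero) (∑-mono-≤ (f≤g ∘ suc))

∑-mod : ∀ {n m} {f g : Fin n → ℕ} → (∀ i → f i ≡ g i [mod m ]) → sum f ≡ sum g [mod m ]
∑-mod {zero}  f≡g = mod-refl
∑-mod {suc n} f≡g = mod-+ (f≡g zero) (∑-mod (f≡g ∘ suc))

∑-shift : ∀ n (g : ℕ → ℕ) → g 0 + ∑[ j < n ] g (suc (toℕ j)) ≡ ∑[ j < n ] g (toℕ j) + g n
∑-shift zero    g = +-comm (g 0) 0
∑-shift (suc n) g = begin
  g 0 + (g 1 + ∑[ j < n ] g (2 + toℕ j))         ≡⟨ cong (g 0 +_) (∑-shift n (g ∘ suc)) ⟩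
  g 0 + (∑[ j < n ] g (suc (toℕ j)) + g (suc n)) ≡⟨ +-assoc (g 0) _ _ ⟨
  g 0 + ∑[ j < n ] g (suc (toℕ j)) + g (suc n)   ∎
  where open ≡-Reasoning

∑-toℕ : ∀ n → ∑[ i < n ] toℕ i ≡ n C 2
∑-toℕ zero    = refl
∑-toℕ (suc n) = begin
  ∑[ i < n ] (1 + toℕ i) ≡⟨ ∑-const+ 1 (toℕ {n}) ⟩
  n * 1 + ∑[ i < n ] toℕ i ≡⟨ cong₂ _+_ (trans (*-identityʳ n) (sym (nC1≡n n))) (∑-toℕ n) ⟩
  n C 1 + n C 2          ≡⟨ nCk+nC[k+1]≡[n+1]C[k+1] n 1 ⟩
  suc n C 2              ∎
  where open ≡-Reasoning

private variable d : ℕ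

δ : Fin d → Fin d → ℕ
δ i g = if does (i ≟ g) then 1 else 0

multiplicity : List (Fin d) → Fin d → ℕ
multiplicity []      i = 0
multiplicity (g ∷ w) i = δ i g + multiplicity w i

extra : (Fin d → ℕ) → Fin d → ℕ
extra a zero    = 0
extra a (suc j) = a (suc j)

-- The endpoint of every walk using each generator g exactly a g times.
position : (Fin d → ℕ) → Fin d → ℕ
position a i = sum a + extra a i

extra-cong : ∀ {a b : Fin d → ℕ} → a ≗ b → extra a ≗ extra b
extra-cong a≗b zero    = refl
extra-cong a≗b (suc i) = a≗b (suc i)

extra-+ : ∀ (a b : Fin d → ℕ) i → extra (λ k → a k + b k) i ≡ extra a i + extra b i
extra-+ a b zero    = refl
extra-+ a b (suc i) = refl

position-cong : ∀ {a b : Fin d → ℕ} → a ≗ b → position a ≗ position b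
position-cong {d} a≗b i = cong₂ _+_ (sum-cong-≗ {d} a≗b) (extra-cong a≗b i)

gen≡1+extra-δ : ∀ (g i : Fin d) → gen g i ≡ suc (extra (λ k → δ k g) i)
gen≡1+extra-δ zero    zero    = refl
gen≡1+extra-δ zero    (suc i) = refl
gen≡1+extra-δ (suc g) zero    = refl
gen≡1+extra-δ (suc g) (suc i) with does (i ≟ g)
... | true  = refl
... | false = refl

∑-δ : ∀ (g : Fin d) → ∑[ i < d ] δ i g ≡ 1
∑-δ {suc d} zero    = cong suc (trans (∑-const d 0) (*-zeroʳ d))
∑-δ {suc d} (suc g) = ∑-δ g

∑-multiplicity : ∀ (w : List (Fin d)) → sum (multiplicity w) ≡ length w
∑-multiplicity {d} []      = trans (∑-const d 0) (*-zeroʳ d)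
∑-multiplicity {d} (g ∷ w) = begin
  sum (multiplicity (g ∷ w))              ≡⟨ ∑-distrib-+ (λ i → δ i g) (multiplicity w) ⟩
  ∑[ i < d ] δ i g + sum (multiplicity w) ≡⟨ cong₂ _+_ (∑-δ g) (∑-multiplicity w) ⟩
  suc (length w)                          ∎
  where open ≡-Reasoning

endpoint≡length+extra : ∀ (w : List (Fin d)) i → endpoint w i ≡ length w + extra (multiplicity w) i
endpoint≡length+extra []      zero    = refl
endpoint≡length+extra []      (suc i) = refl
endpoint≡length+extra (g ∷ w) i = begin
  gen g i + endpoint w i
    ≡⟨ cong₂ _+_ (gen≡1+extra-δ g i) (endpoint≡length+extra w i) ⟩
  suc (extra (λ k → δ k g) i) + (length w + extra (multiplicity w) i)
    ≡⟨ cong suc (x∙yz≈y∙xz (extra (λ k → δ k g) i) (length w) _) ⟩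
  suc (length w) + (extra (λ k → δ k g) i + extra (multiplicity w) i)
    ≡⟨ cong (suc (length w) +_) (extra-+ (λ k → δ k g) (multiplicity w) i) ⟨
  suc (length w) + extra (multiplicity (g ∷ w)) i
    ∎
  where open ≡-Reasoning

endpoint≡position : ∀ (w : List (Fin d)) i → endpoint w i ≡ position (multiplicity w) i
endpoint≡position w i =
  trans (endpoint≡length+extra w i) (cong (_+ extra (multiplicity w) i) (sym (∑-multiplicity w)))

walkWith : (Fin d → ℕ) → List (Fin d)
walkWith {zero}  a = []
walkWith {suc d} a = replicate (a zero) zero ++ map suc (walkWith (a ∘ suc))

multiplicity-++ : ∀ (u w : List (Fin d)) i → multiplicity (u ++ w) i ≡ multiplicity u i + multiplicity w i
multiplicity-++ []      w i = refl
multiplicity-++ (g ∷ u) w i = trans (cong (δ i g +_) (multiplicity-++ u w i)) (sym (+-assoc (δ i g) _ _))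

multiplicity-replicate-zero : ∀ k → multiplicity (replicate k (zero {d})) ≗ λ i → δ i zero * k
multiplicity-replicate-zero zero    i       = sym (*-zeroʳ (δ i zero))
multiplicity-replicate-zero (suc k) zero    = cong suc (multiplicity-replicate-zero k zero)
multiplicity-replicate-zero (suc k) (suc i) = multiplicity-replicate-zero k (suc i)

multiplicity-map-suc-zero : ∀ (w : List (Fin d)) → multiplicity (map suc w) zero ≡ 0
multiplicity-map-suc-zero []      = refl
multiplicity-map-suc-zero (g ∷ w) = multiplicity-map-suc-zero w

multiplicity-map-suc : ∀ (w : List (Fin d)) i → multiplicity (map suc w) (suc i) ≡ multiplicity w i
multiplicity-map-suc []      i = refl
multiplicity-map-suc (g ∷ w) i = cong (δ i g +_) (multiplicity-map-suc w i)

multiplicity-walkWith : ∀ (a : Fin d → ℕ) → multiplicity (walkWith a) ≗ a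
multiplicity-walkWith {suc d} a i = begin
  multiplicity (replicate (a zero) zero ++ tail-walk) i
    ≡⟨ multiplicity-++ (replicate (a zero) zero) tail-walk i ⟩
  multiplicity (replicate (a zero) zero) i + multiplicity tail-walk i
    ≡⟨ cong (_+ multiplicity tail-walk i) (multiplicity-replicate-zero (a zero) i) ⟩
  δ i zero * a zero + multiplicity tail-walk i
    ≡⟨ by-coordinate i ⟩
  a i
    ∎
  where
  open ≡-Reasoning
  tail-walk : List (Fin (suc d))
  tail-walk = map suc (walkWith (a ∘ suc))
  by-coordinate : ∀ i → δ i zero * a zero + multiplicity tail-walk i ≡ a i
  by-coordinate zero    = trans (cong₂ _+_ (*-identityˡ (a zero)) (multiplicity-map-suc-zero (walkWith (a ∘ suc))))
                                (+-identityʳ (a zero))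
  by-coordinate (suc i) = trans (multiplicity-map-suc (walkWith (a ∘ suc)) i) (multiplicity-walkWith (a ∘ suc) i)

length-walkWith : ∀ (a : Fin d → ℕ) → length (walkWith a) ≡ sum a
length-walkWith a = trans (sym (∑-multiplicity (walkWith a))) (sum-cong-≗ (multiplicity-walkWith a))

endpoint-walkWith : ∀ (a : Fin d → ℕ) i → endpoint (walkWith a) i ≡ position a i
endpoint-walkWith a i = trans (endpoint≡length+extra (walkWith a) i)
                              (cong₂ _+_ (length-walkWith a) (extra-cong (multiplicity-walkWith a) i))

argmin-upTo : ∀ (g : ℕ → ℕ) N → ∃ λ l → ∀ {μ} → μ ≤ N → g l ≤ g μ
argmin-upTo g zero    = 0 , λ { z≤n → ≤-refl }
argmin-upTo g (suc N) with argmin-upTo g N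
... | l , l-min with g l ≤? g (suc N)
...   | yes gl≤ = l , λ μ≤ → [ l-min ∘ s≤s⁻¹ , (λ { refl → gl≤ }) ]′ (m≤n⇒m<n∨m≡n μ≤)
...   | no  gl≰ = suc N , λ μ≤ →
  [ (λ μ< → ≤-trans (<⇒≤ (≰⇒> gl≰)) (l-min (s≤s⁻¹ μ<))) , (λ { refl → ≤-refl }) ]′
  (m≤n⇒m<n∨m≡n μ≤)

periodic-argmin : ∀ (g : ℕ → ℕ) n → (∀ μ → g μ ≡ g (μ % suc n)) → ∃ λ l → ∀ μ → g l ≤ g μ
periodic-argmin g n periodic with argmin-upTo g n
... | l , l-min = l , λ μ → subst (g l ≤_) (sym (periodic μ)) (l-min (s≤s⁻¹ (m%n<n μ (suc n))))

-- Each summand is 0 or 1, and it is 1 exactly for the last p values of j.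
layer-cake : ∀ n p → p ≤ n → ∑[ j < n ] ((p + suc (toℕ j)) / suc n) ≡ p
layer-cake n zero    _   =
  trans (sum-cong-≗ {n} (λ j → m<n⇒m/n≡0 (s≤s (toℕ<n j)))) (trans (∑-const n 0) (*-zeroʳ n))
layer-cake n (suc p) p<n = +-cancelˡ-≡ (g 0) _ _ (begin
  g 0 + ∑[ j < n ] ((suc p + suc (toℕ j)) / suc n) ≡⟨ cong (g 0 +_) (sum-cong-≗ {n} (g-shift ∘ toℕ)) ⟩
  g 0 + ∑[ j < n ] g (suc (toℕ j))                 ≡⟨ ∑-shift n g ⟩
  ∑[ j < n ] g (toℕ j) + g n                       ≡⟨ cong₂ _+_ (layer-cake n p (<⇒≤ p<n)) gn≡1 ⟩
  p + 1                                            ≡⟨ +-comm p 1 ⟩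
  suc p                                            ≡⟨ cong (_+ suc p) g0≡0 ⟨
  g 0 + suc p                                      ∎)
  where
  open ≡-Reasoning
  g : ℕ → ℕ
  g j = (p + suc j) / suc n
  g-shift : ∀ j → (suc p + suc j) / suc n ≡ g (suc j)
  g-shift j = cong (_/ suc n) (sym (+-suc p (suc j)))
  g0≡0 : g 0 ≡ 0
  g0≡0 = m<n⇒m/n≡0 (s≤s (subst (_≤ n) (+-comm 1 p) p<n))
  gn≡1 : g n ≡ 1
  gn≡1 = begin
    (p + suc n) / suc n             ≡⟨ m/n≡1+[m∸n]/n (m≤n+m (suc n) p) ⟩
    1 + (p + suc n ∸ suc n) / suc n ≡⟨ cong (λ x → 1 + x / suc n) (m+n∸n≡m p (suc n)) ⟩
    1 + p / suc n                   ≡⟨ cong (1 +_) (m<n⇒m/n≡0 (≤-trans (n≤1+n (suc p)) (s≤s p<n))) ⟩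
    1                               ∎

-- Counts the i for which p i + j wraps around modulo n + 1, provided p i ≤ n and j ≤ n + 1.
carries : ∀ {n} → (Fin n → ℕ) → ℕ → ℕ
carries {n} p j = ∑[ i < n ] ((p i + j) / suc n)

∑≡∑-carries : ∀ {n} (p : Fin n → ℕ) → (∀ i → p i ≤ n) →
  sum p ≡ ∑[ j < n ] carries p (suc (toℕ j))
∑≡∑-carries {n} p p≤n = begin
  sum p                                               ≡⟨ sum-cong-≗ {n} (λ i → layer-cake n (p i) (p≤n i)) ⟨
  ∑[ i < n ] ∑[ j < n ] ((p i + suc (toℕ j)) / suc n) ≡⟨ ∑-comm {n} {n} (λ i j → (p i + suc (toℕ j)) / suc n) ⟩
  ∑[ j < n ] carries p (suc (toℕ j))                  ∎
  where open ≡-Reasoning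

∑-%+carries : ∀ {n} (p : Fin n → ℕ) j →
  ∑[ i < n ] ((p i + j) % suc n) + carries p j * suc n ≡ sum p + n * j
∑-%+carries {n} p j = begin
  ∑[ i < n ] ((p i + j) % suc n) + carries p j * suc n
    ≡⟨ cong (∑[ i < n ] ((p i + j) % suc n) +_) (*-distribʳ-sum (suc n) (λ i → (p i + j) / suc n)) ⟩
  ∑[ i < n ] ((p i + j) % suc n) + ∑[ i < n ] ((p i + j) / suc n * suc n)
    ≡⟨ ∑-distrib-+ (λ i → (p i + j) % suc n) (λ i → (p i + j) / suc n * suc n) ⟨
  ∑[ i < n ] ((p i + j) % suc n + (p i + j) / suc n * suc n)
    ≡⟨ sum-cong-≗ {n} (λ i → m≡m%n+[m/n]*n (p i + j) (suc n)) ⟨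
  ∑[ i < n ] (p i + j)
    ≡⟨ ∑-distrib-+ p (λ _ → j) ⟩
  sum p + ∑[ i < n ] j
    ≡⟨ cong (sum p +_) (∑-const n j) ⟩
  sum p + n * j
    ∎
  where open ≡-Reasoning

-- Minimality gives carries p (1 + j) · (n + 1) ≤ n (1 + j).
carries≤ : ∀ {n} (p : Fin n → ℕ) → (∀ j → sum p ≤ ∑[ i < n ] ((p i + j) % suc n)) →
  ∀ j → carries p (suc j) ≤ j
carries≤ {n} p minimal j = s≤s⁻¹ (*-cancelʳ-< (suc n) (carries p (suc j)) (suc j) (begin-strict
  carries p (suc j) * suc n ≤⟨ +-cancelˡ-≤ (sum p) _ _ (begin
    sum p + carries p (suc j) * suc n                              ≤⟨ +-monoˡ-≤ _ (minimal (suc j)) ⟩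
    ∑[ i < n ] ((p i + suc j) % suc n) + carries p (suc j) * suc n ≡⟨ ∑-%+carries p (suc j) ⟩
    sum p + n * suc j                                              ∎) ⟩
  n * suc j                 <⟨ *-monoˡ-< (suc j) (n<1+n n) ⟩
  suc n * suc j             ≡⟨ *-comm (suc n) (suc j) ⟩
  suc j * suc n             ∎))
  where open ≤-Reasoning

shift-minimal⇒∑≤C2 : ∀ {n} (p : Fin n → ℕ) → (∀ i → p i ≤ n) →
  (∀ j → sum p ≤ ∑[ i < n ] ((p i + j) % suc n)) → sum p ≤ n C 2
shift-minimal⇒∑≤C2 {n} p p≤n minimal = begin
  sum p                              ≡⟨ ∑≡∑-carries p p≤n ⟩
  ∑[ j < n ] carries p (suc (toℕ j)) ≤⟨ ∑-mono-≤ {n} (λ j → carries≤ p minimal (toℕ j)) ⟩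
  ∑[ j < n ] toℕ j                   ≡⟨ ∑-toℕ n ⟩
  n C 2                              ∎
  where open ≤-Reasoning

-- Averaging over all shifts only gives n²/2, so l is chosen to minimise the residue sum.
shift-residues≤C2 : ∀ n (y : Fin n → ℕ) → ∃ λ l → ∑[ i < n ] ((y i + l) % suc n) ≤ n C 2
shift-residues≤C2 n y = l , shift-minimal⇒∑≤C2 p (λ i → s≤s⁻¹ (m%n<n (y i + l) (suc n))) minimal
  where
  f : ℕ → ℕ
  f μ = ∑[ i < n ] ((y i + μ) % suc n)
  f-periodic : ∀ μ → f μ ≡ f (μ % suc n)
  f-periodic μ = sum-cong-≗ {n} (λ i → mod⇒%≡% (mod-+ˡ (y i) (mod-sym (%≡[mod] μ))))
  l : ℕ
  l = proj₁ (periodic-argmin f n f-periodic)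
  p : Fin n → ℕ
  p i = (y i + l) % suc n
  minimal : ∀ j → sum p ≤ ∑[ i < n ] ((p i + j) % suc n)
  minimal j = subst (sum p ≤_) (sum-cong-≗ {n} λ i → mod⇒%≡% (shifted i))
                               (proj₂ (periodic-argmin f n f-periodic) (l + j))
    where
    shifted : ∀ i → y i + (l + j) ≡ p i + j [mod suc n ]
    shifted i = mod-trans (mod-reflexive (sym (+-assoc (y i) l j)))
                          (mod-+ʳ j (mod-sym (%≡[mod] (y i + l))))

∑-toℕ+c%≥C2 : ∀ d c → d C 2 ≤ ∑[ i < d ] ((toℕ i + c) % suc d)
∑-toℕ+c%≥C2 d c = subst (d C 2 ≤_) (sum-cong-≗ {d} λ i → mod⇒%≡% (mod-+ˡ (toℕ i) (%≡[mod] c)))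
                                    (residue-case (c % suc d) (s≤s⁻¹ (m%n<n c (suc d))))
  where
  residue-case : ∀ r → r ≤ d → d C 2 ≤ ∑[ i < d ] ((toℕ i + r) % suc d)
  residue-case zero    _   = ≤-reflexive (begin
    d C 2                            ≡⟨ ∑-toℕ d ⟨
    ∑[ i < d ] toℕ i                 ≡⟨ sum-cong-≗ {d} unshifted ⟨
    ∑[ i < d ] ((toℕ i + 0) % suc d) ∎)
    where
    open ≡-Reasoning
    unshifted : ∀ i → (toℕ i + 0) % suc d ≡ toℕ i
    unshifted i = trans (cong (_% suc d) (+-identityʳ (toℕ i))) (m<n⇒m%n≡m (m<n⇒m<1+n (toℕ<n i)))
  -- Exactly r of the d summands toℕ i + (1 + r) wrap around.
  residue-case (suc r) r<d = +-cancelʳ-≤ (r * suc d) _ _ (begin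
    d C 2 + r * suc d                     ≤⟨ +-monoʳ-≤ (d C 2) r*[1+d]≤d*[1+r] ⟩
    d C 2 + d * suc r                     ≡⟨ cong (_+ d * suc r) (∑-toℕ d) ⟨
    sum (toℕ {d}) + d * suc r             ≡⟨ ∑-%+carries (toℕ {d}) (suc r) ⟨
    G + carries (toℕ {d}) (suc r) * suc d ≡⟨ cong (λ x → G + x * suc d) carries-toℕ ⟩
    G + r * suc d                         ∎)
    where
    open ≤-Reasoning
    G : ℕ
    G = ∑[ i < d ] ((toℕ i + suc r) % suc d)
    carries-toℕ : carries (toℕ {d}) (suc r) ≡ r
    carries-toℕ = trans (sum-cong-≗ {d} (λ i → cong (_/ suc d) (swap (toℕ i)))) (layer-cake d r (<⇒≤ r<d))
      where
      swap : ∀ k → k + suc r ≡ r + suc k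
      swap k = trans (+-comm k (suc r)) (sym (+-suc r k))
    r*[1+d]≤d*[1+r] : r * suc d ≤ d * suc r
    r*[1+d]≤d*[1+r] = begin
      r * suc d ≡⟨ *-suc r d ⟩
      r + r * d ≤⟨ +-monoˡ-≤ (r * d) (<⇒≤ r<d) ⟩
      d + r * d ≡⟨ cong (d +_) (*-comm r d) ⟩
      d + d * r ≡⟨ *-suc d r ⟨
      d * suc r ∎

SameVertex : ∀ d t → (Fin d → ℕ) → (Fin d → ℕ) → Set
SameVertex d t a b = ∀ i → position a i ≡ position b i [mod modulus d t i ]

sameVertex-trans : ∀ {d t} {a b c : Fin d → ℕ} →
  SameVertex d t a b → SameVertex d t b c → SameVertex d t a c
sameVertex-trans a~b b~c i = mod-trans (a~b i) (b~c i)

Realises : ∀ d t → (Fin d → ℕ) → Vertex d t → Set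
Realises d t a v = ∀ i → position a i ≡ toℕ (v i) [mod modulus d t i ]

modulus-weaken : ∀ {d} t i {x y} → x ≡ y [mod t * suc d ] → x ≡ y [mod modulus d t i ]
modulus-weaken {d} t zero    = mod-*ʳ-weaken (suc d)
modulus-weaken     t (suc j) = λ x≡y → x≡y

walkWith-reaches : ∀ {d t} {a} {v : Vertex d t} → Realises d t a v → Reaches d t (walkWith a) v
walkWith-reaches {a = a} realises i =
  mod⇒∣∣-∣ (mod-trans (mod-reflexive (endpoint-walkWith a i)) (realises i))

multiplicity-realises : ∀ {d t} {w} {v : Vertex d t} → Reaches d t w v → Realises d t (multiplicity w) v
multiplicity-realises {w = w} reaches i =
  mod-trans (mod-reflexive (sym (endpoint≡position w i))) (∣∣-∣⇒mod (reaches i))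

sameVertex-realises : ∀ {d t} {a b} {v : Vertex d t} →
  SameVertex d t a b → Realises d t b v → Realises d t a v
sameVertex-realises a~b b-realises i = mod-trans (a~b i) (b-realises i)

realisers-sameVertex : ∀ {d t} {a b} {v : Vertex d t} →
  Realises d t a v → Realises d t b v → SameVertex d t a b
realisers-sameVertex a-realises b-realises i = mod-trans (a-realises i) (mod-sym (b-realises i))

≡[mod]⇒sameVertex : ∀ {d} t {a b : Fin d → ℕ} →
  (∀ i → a i ≡ b i [mod t * suc d ]) → SameVertex d t a b
≡[mod]⇒sameVertex {d} t {a} {b} a≡b i = modulus-weaken t i (mod-+ (∑-mod a≡b) (extra-mod i))
  where
  extra-mod : ∀ i → extra a i ≡ extra b i [mod t * suc d ]
  extra-mod zero    = mod-refl
  extra-mod (suc j) = a≡b (suc j)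

sameVertex-+multiple : ∀ {d} t (a : Fin d → ℕ) c → SameVertex d t (λ i → c * t + a i) a
sameVertex-+multiple {d} t a c zero = begin
  sum (λ i → c * t + a i) + 0 ≡⟨ cong (_+ 0) (∑-const+ (c * t) a) ⟩
  d * (c * t) + sum a + 0     ≡⟨ regroup (sum a) d c t ⟩
  sum a + 0 + d * c * t       ≈⟨ +-multiple≡[mod] (sum a + 0) (d * c) ⟩
  sum a + 0                   ∎
  where
  open ≡[mod]-Reasoning t
  regroup : ∀ s d c t → d * (c * t) + s + 0 ≡ s + 0 + d * c * t
  regroup = solve-∀
sameVertex-+multiple {d} t a c (suc j) = begin
  sum (λ i → c * t + a i) + (c * t + a (suc j)) ≡⟨ cong (_+ (c * t + a (suc j))) (∑-const+ (c * t) a) ⟩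
  d * (c * t) + sum a + (c * t + a (suc j))     ≡⟨ regroup (sum a) (a (suc j)) d c t ⟩
  sum a + a (suc j) + c * (t * suc d)           ≈⟨ +-multiple≡[mod] (sum a + a (suc j)) c ⟩
  sum a + a (suc j)                             ∎
  where
  open ≡[mod]-Reasoning (t * suc d)
  regroup : ∀ s x d c t → d * (c * t) + s + (c * t + x) ≡ s + x + c * (t * suc d)
  regroup = solve-∀

-- Multiplying by m acts as negation modulo m + 1, which makes the multiplicities explicit.
position-onto : ∀ {d} m (x : Fin d → ℕ) → ∃ λ a → ∀ i → position a i ≡ x i [mod suc m ]
position-onto {zero}  m x = (λ ()) , λ ()
position-onto {suc e} m x = a , reach
  where
  rest : Fin e → ℕ
  rest j = x (suc j) + m * x zero
  a : Fin (suc e) → ℕ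
  a zero    = x zero + m * sum rest
  a (suc j) = rest j
  reach : ∀ i → position a i ≡ x i [mod suc m ]
  reach zero    = begin
    x zero + m * sum rest + sum rest + 0 ≡⟨ regroup₀ (x zero) (sum rest) m ⟩
    x zero + sum rest * suc m            ≈⟨ +-multiple≡[mod] (x zero) (sum rest) ⟩
    x zero                               ∎
    where
    open ≡[mod]-Reasoning (suc m)
    regroup₀ : ∀ x₀ s m → x₀ + m * s + s + 0 ≡ x₀ + s * suc m
    regroup₀ = solve-∀
  reach (suc j) = begin
    x zero + m * sum rest + sum rest + rest j ≡⟨ regroup (x zero) (x (suc j)) (sum rest) m ⟩
    x (suc j) + (sum rest + x zero) * suc m   ≈⟨ +-multiple≡[mod] (x (suc j)) (sum rest + x zero) ⟩
    x (suc j)                                 ∎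
    where
    open ≡[mod]-Reasoning (suc m)
    regroup : ∀ x₀ x s m → x₀ + m * s + s + (x + m * x₀) ≡ x + (s + x₀) * suc m
    regroup = solve-∀

realisable : ∀ {d} t' (v : Vertex d (suc t')) → ∃ λ a → Realises d (suc t') a v
realisable {d} t' v with position-onto (d + t' * suc d) (toℕ ∘ v)
... | a , reach = a , λ i → modulus-weaken (suc t') i (reach i)

short-representative : ∀ {d} t' (b : Fin d → ℕ) →
  ∃ λ a → SameVertex d (suc t') a b × sum a ≤ suc t' * (d C 2) + d * t'
short-representative {d} t' b =
  a , sameVertex-trans (≡[mod]⇒sameVertex t a≡b+lt) (sameVertex-+multiple t b l) , ∑a≤
  where
  t : ℕ
  t = suc t'
  y : Fin d → ℕ
  y i = b i / t
  l : ℕ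
  l = proj₁ (shift-residues≤C2 d y)
  p : Fin d → ℕ
  p i = (y i + l) % suc d
  a : Fin d → ℕ
  a i = t * p i + b i % t
  a≡b+lt : ∀ i → a i ≡ l * t + b i [mod t * suc d ]
  a≡b+lt i = begin
    a i                                            ≈⟨ mod-sym (+-multiple≡[mod] (a i) ((y i + l) / suc d)) ⟩
    a i + (y i + l) / suc d * (t * suc d)          ≡⟨ regroup t (p i) (b i % t) ((y i + l) / suc d) (suc d) ⟩
    b i % t + (p i + (y i + l) / suc d * suc d) * t ≡⟨ cong (λ n → b i % t + n * t) (m≡m%n+[m/n]*n (y i + l) (suc d)) ⟨
    b i % t + (y i + l) * t                        ≡⟨ regroup′ (b i % t) (y i) l t ⟩
    l * t + (b i % t + y i * t)                    ≡⟨ cong (l * t +_) (m≡m%n+[m/n]*n (b i) t) ⟨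
    l * t + b i                                    ∎
    where
    open ≡[mod]-Reasoning (t * suc d)
    regroup : ∀ t p z q M → t * p + z + q * (t * M) ≡ z + (p + q * M) * t
    regroup = solve-∀
    regroup′ : ∀ z y l t → z + (y + l) * t ≡ l * t + (z + y * t)
    regroup′ = solve-∀
  ∑a≤ : sum a ≤ t * (d C 2) + d * t'
  ∑a≤ = begin
    sum a                                       ≡⟨ ∑-distrib-+ (λ i → t * p i) (λ i → b i % t) ⟩
    ∑[ i < d ] (t * p i) + ∑[ i < d ] (b i % t) ≡⟨ cong (_+ ∑[ i < d ] (b i % t)) (*-distribˡ-sum t p) ⟨
    t * sum p + ∑[ i < d ] (b i % t)            ≤⟨ +-mono-≤ (*-monoʳ-≤ t (proj₂ (shift-residues≤C2 d y)))
                                                      (∑-mono-≤ {d} (λ i → s≤s⁻¹ (m%n<n (b i) t))) ⟩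
    t * (d C 2) + ∑[ i < d ] t'                 ≡⟨ cong (t * (d C 2) +_) (∑-const d t') ⟩
    t * (d C 2) + d * t'                        ∎
    where open ≤-Reasoning

sameVertex⇒≡[mod] : ∀ {d t} {a b : Fin d → ℕ} → SameVertex d t a b → ∀ i → a i ≡ b i [mod t ]
sameVertex⇒≡[mod] {suc e} {t} {a} {b} a~b = componentwise
  where
  ∑≡ : sum a ≡ sum b [mod t ]
  ∑≡ = begin
    sum a     ≡⟨ +-identityʳ (sum a) ⟨
    sum a + 0 ≈⟨ a~b zero ⟩
    sum b + 0 ≡⟨ +-identityʳ (sum b) ⟩
    sum b     ∎
    where open ≡[mod]-Reasoning t
  tail≡ : ∀ j → a (suc j) ≡ b (suc j) [mod t ]
  tail≡ j = mod-+-cancelˡ ∑≡ (mod-*ʳ-weaken (suc (suc e)) (a~b (suc j)))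
  componentwise : ∀ i → a i ≡ b i [mod t ]
  componentwise zero    = mod-+-cancelˡ (∑-mod tail≡)
    (mod-trans (mod-reflexive (+-comm _ (a zero))) (mod-trans ∑≡ (mod-reflexive (+-comm (b zero) _))))
  componentwise (suc j) = tail≡ j

sameVertex⇒tail-congruence : ∀ {e} t' r {q π : Fin (suc e) → ℕ} →
  SameVertex (suc e) (suc t') (λ i → r + suc t' * q i) (λ i → r + suc t' * π i) →
  ∀ j → sum q + q (suc j) ≡ sum π + π (suc j) [mod suc (suc e) ]
sameVertex⇒tail-congruence {e} t' r {q} {π} qt~πt j =
  mod-*-cancelˡ (suc t') (mod-+-cancelˡ (mod-refl {x = suc e * r + r}) (begin
    suc e * r + r + suc t' * (sum q + q (suc j))                 ≡⟨ regroup q (q (suc j)) ⟨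
    ∑[ i < suc e ] (r + suc t' * q i) + (r + suc t' * q (suc j)) ≈⟨ qt~πt (suc j) ⟩
    ∑[ i < suc e ] (r + suc t' * π i) + (r + suc t' * π (suc j)) ≡⟨ regroup π (π (suc j)) ⟩
    suc e * r + r + suc t' * (sum π + π (suc j))                 ∎))
  where
  open ≡[mod]-Reasoning (suc t' * suc (suc e))
  regroup : ∀ (q : Fin (suc e) → ℕ) x →
    ∑[ i < suc e ] (r + suc t' * q i) + (r + suc t' * x) ≡ suc e * r + r + suc t' * (sum q + x)
  regroup q x = trans (cong (_+ (r + suc t' * x)) (∑-affine r (suc t') q)) (shuffle (suc e * r) r (suc t') (sum q) x)
    where
    shuffle : ∀ A r t Q x → A + t * Q + (r + t * x) ≡ A + r + t * (Q + x)
    shuffle = solve-∀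

-- Modulo e + 2, multiplying by e + 1 is negation, so every q i - π i is congruent to sum π - sum q.
tail-congruence⇒≡[mod] : ∀ {e} (q π : Fin (suc e) → ℕ) →
  (∀ j → sum q + q (suc j) ≡ sum π + π (suc j) [mod suc (suc e) ]) →
  ∀ i → q i ≡ π i + (sum π + suc e * sum q) [mod suc (suc e) ]
tail-congruence⇒≡[mod] {e} q π tails zero = mod-+-cancelˡ (mod-refl {x = Tq}) (begin
  Tq + q zero                         ≈⟨ mod-sym (+-multiple≡[mod] (Tq + q zero) (sum π)) ⟩
  Tq + q zero + sum π * suc (suc e)   ≡⟨ regroup₁ (π zero) Tπ (q zero) Tq e ⟩
  π zero + sum π + sum q + (e * sum π + Tπ) ≈⟨ mod-+ˡ (π zero + sum π + sum q) (mod-sym tails-summed) ⟩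
  π zero + sum π + sum q + (e * sum q + Tq) ≡⟨ regroup₂ (π zero) (sum π) (sum q) Tq e ⟩
  Tq + (π zero + (sum π + suc e * sum q)) ∎)
  where
  open ≡[mod]-Reasoning (suc (suc e))
  Tq Tπ : ℕ
  Tq = sum (q ∘ suc)
  Tπ = sum (π ∘ suc)
  tails-summed : e * sum q + Tq ≡ e * sum π + Tπ [mod suc (suc e) ]
  tails-summed = mod-trans (mod-reflexive (sym (∑-const+ (sum q) (q ∘ suc))))
                 (mod-trans (∑-mod tails) (mod-reflexive (∑-const+ (sum π) (π ∘ suc))))
  regroup₁ : ∀ π₀ Tπ q₀ Tq e →
    Tq + q₀ + (π₀ + Tπ) * suc (suc e) ≡ π₀ + (π₀ + Tπ) + (q₀ + Tq) + (e * (π₀ + Tπ) + Tπ)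
  regroup₁ = solve-∀
  regroup₂ : ∀ π₀ P Q Tq e → π₀ + P + Q + (e * Q + Tq) ≡ Tq + (π₀ + (P + suc e * Q))
  regroup₂ = solve-∀
tail-congruence⇒≡[mod] {e} q π tails (suc j) = begin
  q (suc j)                                ≈⟨ mod-sym (+-multiple≡[mod] (q (suc j)) (sum q)) ⟩
  q (suc j) + sum q * suc (suc e)          ≡⟨ regroup₁ (q (suc j)) (sum q) e ⟩
  sum q + q (suc j) + suc e * sum q        ≈⟨ mod-+ʳ (suc e * sum q) (tails j) ⟩
  sum π + π (suc j) + suc e * sum q        ≡⟨ regroup₂ (sum π) (π (suc j)) (suc e * sum q) ⟩
  π (suc j) + (sum π + suc e * sum q)      ∎
  where
  open ≡[mod]-Reasoning (suc (suc e))
  regroup₁ : ∀ x Q e → x + Q * suc (suc e) ≡ Q + x + suc e * Q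
  regroup₁ = solve-∀
  regroup₂ : ∀ P x R → P + x + R ≡ x + (P + R)
  regroup₂ = solve-∀

≡toℕ+c⇒C2≤∑ : ∀ {d} c (q : Fin d → ℕ) →
  (∀ i → q i ≡ toℕ i + c [mod suc d ]) → d C 2 ≤ sum q
≡toℕ+c⇒C2≤∑ {d} c q q≡ = begin
  d C 2                            ≤⟨ ∑-toℕ+c%≥C2 d c ⟩
  ∑[ i < d ] ((toℕ i + c) % suc d) ≡⟨ sum-cong-≗ {d} (λ i → mod⇒%≡% (q≡ i)) ⟨
  ∑[ i < d ] (q i % suc d)         ≤⟨ ∑-mono-≤ {d} (λ i → m%n≤m (q i) (suc d)) ⟩
  sum q                            ∎
  where open ≤-Reasoning

diameter-formula : ∀ d t' → suc t' * (suc d C 2) ∸ d ≡ suc t' * (d C 2) + d * t'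
diameter-formula d t' = begin
  suc t' * (suc d C 2) ∸ d                    ≡⟨ cong (λ n → suc t' * n ∸ d) (nCk+nC[k+1]≡[n+1]C[k+1] d 1) ⟨
  suc t' * (d C 1 + d C 2) ∸ d                ≡⟨ cong (λ n → suc t' * (n + d C 2) ∸ d) (nC1≡n d) ⟩
  suc t' * (d + d C 2) ∸ d                    ≡⟨ cong (_∸ d) (regroup d (d C 2) t') ⟩
  d + (suc t' * (d C 2) + d * t') ∸ d         ≡⟨ m+n∸m≡n d _ ⟩
  suc t' * (d C 2) + d * t'                   ∎
  where
  open ≡-Reasoning
  regroup : ∀ d c t' → suc t' * (d + c) ≡ d + (suc t' * c + d * t')
  regroup = solve-∀

upper-bound : ∀ d t' (v : Vertex d (suc t')) →
  ∃ λ w → length w ≤ suc t' * (d C 2) + d * t' × Reaches d (suc t') w v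
upper-bound d t' v =
  let b , b-realises = realisable t' v
      a , a~b , ∑a≤   = short-representative t' b
  in walkWith a , ≤-trans (≤-reflexive (length-walkWith a)) ∑a≤ ,
     walkWith-reaches (sameVertex-realises a~b b-realises)

staircase-lower-bound : ∀ e t' (a : Fin (suc e) → ℕ) →
  SameVertex (suc e) (suc t') a (λ i → t' + suc t' * toℕ i) →
  suc t' * (suc e C 2) + suc e * t' ≤ sum a
staircase-lower-bound e t' a a~x = begin
  suc t' * (suc e C 2) + suc e * t'  ≤⟨ +-monoˡ-≤ (suc e * t') (*-monoʳ-≤ (suc t') (≡toℕ+c⇒C2≤∑ _ q q≡)) ⟩
  suc t' * sum q + suc e * t'        ≡⟨ +-comm (suc t' * sum q) (suc e * t') ⟩
  suc e * t' + suc t' * sum q        ≡⟨ ∑-affine t' (suc t') q ⟨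
  ∑[ i < suc e ] (t' + suc t' * q i) ≡⟨ sum-cong-≗ {suc e} a≡ ⟨
  sum a                              ∎
  where
  open ≤-Reasoning
  t : ℕ
  t = suc t'
  q : Fin (suc e) → ℕ
  q i = a i / t
  a%t≡t' : ∀ i → a i % t ≡ t'
  a%t≡t' i = begin-equality
    a i % t              ≡⟨ mod⇒%≡% (sameVertex⇒≡[mod] a~x i) ⟩
    (t' + t * toℕ i) % t ≡⟨ cong (λ n → (t' + n) % t) (*-comm t (toℕ i)) ⟩
    (t' + toℕ i * t) % t ≡⟨ [m+kn]%n≡m%n t' (toℕ i) t ⟩
    t' % t               ≡⟨ m<n⇒m%n≡m (n<1+n t') ⟩
    t'                   ∎
  a≡ : ∀ i → a i ≡ t' + t * q i
  a≡ i = trans (m≡m%n+[m/n]*n (a i) t) (cong₂ _+_ (a%t≡t' i) (*-comm (q i) t))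
  q≡ : ∀ i → q i ≡ toℕ i + _ [mod suc (suc e) ]
  q≡ = tail-congruence⇒≡[mod] q toℕ (sameVertex⇒tail-congruence t' t'
         (λ i → mod-trans (mod-reflexive (sym (position-cong a≡ i))) (a~x i)))

vertexOf : ∀ {d} t' → (Fin d → ℕ) → Vertex d (suc t')
vertexOf     t' x zero    = fromℕ< (m%n<n (position x zero) (suc t'))
vertexOf {d} t' x (suc j) = fromℕ< (m%n<n (position x (suc j)) (suc t' * suc d))

vertexOf-realised : ∀ {d} t' (x : Fin d → ℕ) → Realises d (suc t') x (vertexOf t' x)
vertexOf-realised t' x zero    = subst (position x zero ≡_[mod suc t' ]) (sym (toℕ-fromℕ< _))
                                       (mod-sym (%≡[mod] (position x zero)))
vertexOf-realised {d} t' x (suc j) = subst (position x (suc j) ≡_[mod suc t' * suc d ]) (sym (toℕ-fromℕ< _))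
                                           (mod-sym (%≡[mod] (position x (suc j))))

lower-bound : ∀ e t' → ∃ λ (v : Vertex (suc e) (suc t')) →
  ∀ w → Reaches (suc e) (suc t') w v → suc t' * (suc e C 2) + suc e * t' ≤ length w
lower-bound e t' = vertexOf t' x , λ w reaches →
  subst (_ ≤_) (∑-multiplicity w) (staircase-lower-bound e t' (multiplicity w)
    (realisers-sameVertex (multiplicity-realises {w = w} reaches) (vertexOf-realised t' x)))
  where
  x : Fin (suc e) → ℕ
  x i = t' + suc t' * toℕ i

proposition4 : (d t : ℕ) → 2 ≤ d → 1 ≤ t →
    HasDiameter d t (t * (suc d C 2) ∸ d)
proposition4 zero    _        ()  _
proposition4 (suc e) zero     _   ()
proposition4 (suc e) (suc t') _   _ rewrite diameter-formula (suc e) t' =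
  upper-bound (suc e) t' , lower-bound e t'
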